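{- Let $n\ge 2$, $1\le k\le n-1$, and $p\in S_n$. If $|D_k(p)|=\binom{n}{k}$, then $|D_j(p)|=\binom{n}{j}$ for all $j\in\{1,\ldots,k\}$.
   Context: For $p\in S_n$ (one-line notation) and $0\le j\le n-1$, $D_j(p)$ is the set of permutations in $S_{n-j}$ obtainable from $p$ by deleting $j$ entries and relabelling the remaining entries $1$ through $n-j$ preserving relative order. -}

module Defs where

open import Data.Nat using (ℕ; zero; suc; _<?_; _∸_)
import Data.Nat.Properties as ℕP
open import Data.Fin using (Fin; toℕ)
open import Data.Fin.Permutation using (Permutation′; _⟨$⟩ʳ_)
open import Data.List using (List; []; _∷_; map; length; filter; allFin; deduplicate; _++_)
open import Data.List.Properties using (≡-dec)

-- One-line notation of p ∈ S_n, with entries written as 1..n: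
-- the list p(1) p(2) ... p(n).
oneLine : ∀ {n} → Permutation′ n → List ℕ
oneLine {n} p = map (λ i → suc (toℕ (p ⟨$⟩ʳ i))) (allFin n)

-- All subsequences of length m of a list (choosing which positions to keep),
-- listed with multiplicity (one entry per choice of positions).
subseqs : {A : Set} → ℕ → List A → List (List A)
subseqs zero    _        = [] ∷ []
subseqs (suc m) []       = []
subseqs (suc m) (x ∷ xs) = map (x ∷_) (subseqs m xs) ++ subseqs (suc m) xs

-- Relabel a list of distinct numbers to 1..length preserving relative order:
-- each entry x becomes 1 + #(entries smaller than x).
standardize : List ℕ → List ℕ
standardize xs = map (λ x → suc (length (filter (_<? x) xs))) xs

-- D_j(p): the set (duplicate-free list) of permutations of S_{n-j}, in
-- one-line notation, obtained from p by deleting j entries and relabelling.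
D : ∀ {n} → ℕ → Permutation′ n → List (List ℕ)
D {n} j p = deduplicate (≡-dec ℕP._≟_) (map standardize (subseqs (n ∸ j) (oneLine p)))

∣D∣ : ∀ {n} → ℕ → Permutation′ n → ℕ
∣D∣ j p = length (D j p)

-- |D_j(p)| = C(n,j) says exactly that distinct choices of n − j kept positions
-- of p always yield distinct patterns. Standardizing commutes with selecting
-- further positions, so if two distinct m-sets of positions (m ≥ n − k ≥ 1)
-- yielded the same pattern, then for every way of keeping n − k of those m
-- places the two induced (n − k)-sets would also yield equal patterns; one such
-- way keeps a place where the two m-sets differ, contradicting |D_k(p)| = C(n,k).
module Submission where

open import Defs
open import Data.Nat using (ℕ; zero; suc; _+_; _≤_; _<_; _<?_; _∸_; z≤n; s≤s)
open import Data.Nat.Properties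
  using (m≤n⇒m<n∨m≡n; <-≤-trans; <-trans; <-irrefl; <⇒≤; <⇒≱; ≮⇒≥; ≤-trans; m∸n≤m; ∸-monoʳ-≤; m<n⇒0<n∸m; _≟_)
open import Data.Nat.Combinatorics using (_C_; nCk≡nC[n∸k]; nCk+nC[k+1]≡[n+1]C[k+1])
open import Data.Fin.Permutation using (Permutation′)
open import Data.List using (List; []; _∷_; map; length; filter; allFin; deduplicate; _++_)
open import Data.List.Properties
  using (map-∘; map-++; map-cong-local; length-map; length-++; length-tabulate;
         filter-accept; filter-reject; filter-all; ≡-dec)
open import Data.List.Membership.Propositional using (_∈_)
open import Data.List.Membership.Propositional.Properties using (∈-map⁺; ∈-++⁺ˡ; ∈-++⁺ʳ; ∈-map⁻)
import Data.List.Relation.Unary.All as All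
open import Data.List.Relation.Unary.Any using (here; there)
open import Data.List.Relation.Unary.Unique.Propositional using (Unique; []; _∷_)
open import Data.List.Relation.Unary.Unique.Propositional.Properties using (map⁺; ++⁺)
open import Data.List.Relation.Unary.Unique.DecPropositional.Properties using (deduplicate-!)
open import Data.List.Relation.Binary.Sublist.Propositional using (_⊆_; []; _∷_; _∷ʳ_; ⊆-trans; ⊆-refl; minimum; lookup)
open import Data.List.Relation.Binary.Sublist.Propositional.Properties using (filter-⊆; filter⁺; length-mono-≤)
open import Data.List.Relation.Binary.Sublist.Heterogeneous.Properties using (toPointwise)
open import Data.List.Relation.Binary.Pointwise using (Pointwise-≡⇒≡)
open import Data.Product using (_×_; _,_)
open import Data.Sum using (inj₁; inj₂)
open import Data.Empty using (⊥; ⊥-elim)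
open import Function using (_∘_; _⇔_; mk⇔; Equivalence)
open import Function.Definitions using (Injective)
open import Relation.Binary.Definitions using (DecidableEquality)
open import Relation.Binary.PropositionalEquality
  using (_≡_; refl; sym; trans; cong; cong₂; subst; module ≡-Reasoning)
open import Relation.Nullary using (¬_; ¬?; yes; no)
open import Relation.Nullary.Decidable using (decidable-stable)

private
  variable
    A B : Set
    k m n : ℕ

data Thinning : ℕ → ℕ → Set where
  done : Thinning 0 0
  keep : Thinning m n → Thinning (suc m) (suc n)
  drop : Thinning m n → Thinning m (suc n)

drop-injective : {θ θ′ : Thinning m n} → drop θ ≡ drop θ′ → θ ≡ θ′
drop-injective refl = refl

keep-injective : {θ θ′ : Thinning m n} → keep θ ≡ keep θ′ → θ ≡ θ′
keep-injective refl = refl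

select : Thinning m n → List A → List A
select done     xs       = []
select (keep θ) []       = []
select (keep θ) (x ∷ xs) = x ∷ select θ xs
select (drop θ) []       = []
select (drop θ) (x ∷ xs) = select θ xs

_⊙_ : Thinning k m → Thinning m n → Thinning k n
ψ      ⊙ done   = ψ
ψ      ⊙ drop θ = drop (ψ ⊙ θ)
keep ψ ⊙ keep θ = keep (ψ ⊙ θ)
drop ψ ⊙ keep θ = drop (ψ ⊙ θ)

idᵗ : Thinning m m
idᵗ {zero}  = done
idᵗ {suc m} = keep idᵗ

empty : Thinning 0 n
empty {zero}  = done
empty {suc n} = drop empty

prefix : m ≤ n → Thinning m n
prefix {zero}          _         = empty
prefix {suc m} {suc n} (s≤s m≤n) = keep (prefix m≤n)

idᵗ-⊙ : (θ : Thinning m n) → idᵗ ⊙ θ ≡ θ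
idᵗ-⊙ done     = refl
idᵗ-⊙ (keep θ) = cong keep (idᵗ-⊙ θ)
idᵗ-⊙ (drop θ) = cong drop (idᵗ-⊙ θ)

select-[] : (θ : Thinning m n) → select {A = A} θ [] ≡ []
select-[] done     = refl
select-[] (keep θ) = refl
select-[] (drop θ) = refl

select-empty : (θ : Thinning 0 n) (xs : List A) → select θ xs ≡ []
select-empty done     xs       = refl
select-empty (drop θ) []       = refl
select-empty (drop θ) (x ∷ xs) = select-empty θ xs

select-⊙ : (ψ : Thinning k m) (θ : Thinning m n) (xs : List A) →
           select (ψ ⊙ θ) xs ≡ select ψ (select θ xs)
select-⊙ done     done     xs       = refl
select-⊙ ψ        (drop θ) []       = sym (select-[] ψ)
select-⊙ ψ        (drop θ) (x ∷ xs) = select-⊙ ψ θ xs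
select-⊙ (keep ψ) (keep θ) []       = refl
select-⊙ (keep ψ) (keep θ) (x ∷ xs) = cong (x ∷_) (select-⊙ ψ θ xs)
select-⊙ (drop ψ) (keep θ) []       = refl
select-⊙ (drop ψ) (keep θ) (x ∷ xs) = select-⊙ ψ θ xs

select-map : (f : A → B) (θ : Thinning m n) (xs : List A) →
             select θ (map f xs) ≡ map f (select θ xs)
select-map f done     xs       = refl
select-map f (keep θ) []       = refl
select-map f (keep θ) (x ∷ xs) = cong (f x ∷_) (select-map f θ xs)
select-map f (drop θ) []       = refl
select-map f (drop θ) (x ∷ xs) = select-map f θ xs

select-⊆ : (θ : Thinning m n) (xs : List A) → select θ xs ⊆ xs
select-⊆ done     xs       = minimum xs
select-⊆ (keep θ) []       = []
select-⊆ (keep θ) (x ∷ xs) = refl ∷ select-⊆ θ xs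
select-⊆ (drop θ) []       = []
select-⊆ (drop θ) (x ∷ xs) = x ∷ʳ select-⊆ θ xs

-- At the first place where θ₁ and θ₂ differ, some ψ keeps that place.
thinning-extensionality : 1 ≤ k → k ≤ m → (θ₁ θ₂ : Thinning m n) →
                          (∀ (ψ : Thinning k m) → ψ ⊙ θ₁ ≡ ψ ⊙ θ₂) → θ₁ ≡ θ₂
thinning-extensionality _ _ done done _ = refl
thinning-extensionality 1≤k k≤1+m (keep θ₁) (keep θ₂) agree with m≤n⇒m<n∨m≡n k≤1+m
... | inj₁ (s≤s k≤m) =
  cong keep (thinning-extensionality 1≤k k≤m θ₁ θ₂ (drop-injective ∘ agree ∘ drop))
... | inj₂ refl = trans (sym (idᵗ-⊙ _)) (trans (agree idᵗ) (idᵗ-⊙ _))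
thinning-extensionality (s≤s z≤n) (s≤s k≤m) (keep θ₁) (drop θ₂) agree
  with () ← agree (keep (prefix k≤m))
thinning-extensionality (s≤s z≤n) (s≤s k≤m) (drop θ₁) (keep θ₂) agree
  with () ← agree (keep (prefix k≤m))
thinning-extensionality 1≤k k≤m (drop θ₁) (drop θ₂) agree =
  cong drop (thinning-extensionality 1≤k k≤m θ₁ θ₂ (drop-injective ∘ agree))

thinnings : ∀ m n → List (Thinning m n)
thinnings zero    zero    = done ∷ []
thinnings zero    (suc n) = map drop (thinnings zero n)
thinnings (suc m) zero    = []
thinnings (suc m) (suc n) = map keep (thinnings m n) ++ map drop (thinnings (suc m) n)

thinnings-zero : thinnings 0 n ≡ empty ∷ []
thinnings-zero {zero}  = refl
thinnings-zero {suc n} = cong (map drop) thinnings-zero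

∈-thinnings : (θ : Thinning m n) → θ ∈ thinnings m n
∈-thinnings done = here refl
∈-thinnings {suc m} {suc n} (keep θ) = ∈-++⁺ˡ (∈-map⁺ keep (∈-thinnings θ))
∈-thinnings {zero}  {suc n} (drop θ) = ∈-map⁺ drop (∈-thinnings θ)
∈-thinnings {suc m} {suc n} (drop θ) =
  ∈-++⁺ʳ (map keep (thinnings m n)) (∈-map⁺ drop (∈-thinnings θ))

thinnings-Unique : ∀ m n → Unique (thinnings m n)
thinnings-Unique zero    zero    = All.[] ∷ []
thinnings-Unique zero    (suc n) = map⁺ drop-injective (thinnings-Unique zero n)
thinnings-Unique (suc m) zero    = []
thinnings-Unique (suc m) (suc n) =
  ++⁺ (map⁺ keep-injective (thinnings-Unique m n))
      (map⁺ drop-injective (thinnings-Unique (suc m) n))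
      keep≢drop
  where
  keep≢drop : ∀ {θ} → θ ∈ map keep (thinnings m n) × θ ∈ map drop (thinnings (suc m) n) → ⊥
  keep≢drop (∈keeps , ∈drops) with ∈-map⁻ keep ∈keeps | ∈-map⁻ drop ∈drops
  ... | _ , _ , refl | _ , _ , ()

length-thinnings : ∀ m n → length (thinnings m n) ≡ n C m
length-thinnings zero    zero    = refl
length-thinnings zero    (suc n) = trans (length-map drop (thinnings zero n)) (length-thinnings zero n)
length-thinnings (suc m) zero    = refl
length-thinnings (suc m) (suc n) = begin
  length (map keep (thinnings m n) ++ map drop (thinnings (suc m) n))
    ≡⟨ length-++ (map keep (thinnings m n)) ⟩
  length (map keep (thinnings m n)) + length (map drop (thinnings (suc m) n))
    ≡⟨ cong₂ _+_ (trans (length-map keep (thinnings m n)) (length-thinnings m n))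
                 (trans (length-map drop (thinnings (suc m) n)) (length-thinnings (suc m) n)) ⟩
  n C m + n C suc m
    ≡⟨ nCk+nC[k+1]≡[n+1]C[k+1] n m ⟩
  suc n C suc m ∎
  where open ≡-Reasoning

subseqs-thinnings : ∀ m (xs : List A) →
                    subseqs m xs ≡ map (λ θ → select θ xs) (thinnings m (length xs))
subseqs-thinnings zero xs
  rewrite thinnings-zero {length xs} | select-empty (empty {length xs}) xs = refl
subseqs-thinnings (suc m) []       = refl
subseqs-thinnings (suc m) (x ∷ xs) = begin
  map (x ∷_) (subseqs m xs) ++ subseqs (suc m) xs
    ≡⟨ cong₂ _++_ (cong (map (x ∷_)) (subseqs-thinnings m xs)) (subseqs-thinnings (suc m) xs) ⟩
  map (x ∷_) (map (select′ xs) keeps) ++ map (select′ xs) drops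
    ≡⟨ cong₂ _++_ (trans (sym (map-∘ keeps)) (map-∘ keeps)) (map-∘ drops) ⟩
  map (select′ (x ∷ xs)) (map keep keeps) ++ map (select′ (x ∷ xs)) (map drop drops)
    ≡⟨ sym (map-++ (select′ (x ∷ xs)) (map keep keeps) (map drop drops)) ⟩
  map (select′ (x ∷ xs)) (map keep keeps ++ map drop drops) ∎
  where
  open ≡-Reasoning
  keeps = thinnings m (length xs)
  drops = thinnings (suc m) (length xs)
  select′ : List A → Thinning k n → List A
  select′ ys θ = select θ ys

below : ℕ → List ℕ → ℕ
below x xs = length (filter (_<? x) xs)

-- standardize xs ≡ map (rank xs) xs holds definitionally.
rank : List ℕ → ℕ → ℕ
rank xs x = suc (below x xs)

below-∷-< : ∀ {x z} xs → z < x → below x (z ∷ xs) ≡ suc (below x xs)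
below-∷-< {x} xs z<x = cong length (filter-accept (_<? x) z<x)

below-∷-≮ : ∀ {x z} xs → ¬ z < x → below x (z ∷ xs) ≡ below x xs
below-∷-≮ {x} xs z≮x = cong length (filter-reject (_<? x) z≮x)

below-mono-≤ : ∀ {x y} → y ≤ x → ∀ xs → below y xs ≤ below x xs
below-mono-≤ {x} {y} y≤x xs =
  length-mono-≤ (filter⁺ (_<? y) (_<? x) (λ { refl z<y → <-≤-trans z<y y≤x }) (⊆-refl {x = xs}))

below-∷ : ∀ {x} z xs → below x xs ≤ below x (z ∷ xs)
below-∷ {x} z xs = length-mono-≤ (filter⁺ (_<? x) (_<? x) (λ { refl z<x → z<x }) (z ∷ʳ ⊆-refl))

below-mono-< : ∀ {x y xs} → y < x → y ∈ xs → below y xs < below x xs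
below-mono-< {x} {y} {z ∷ xs} y<x (here refl)
  rewrite below-∷-≮ {y} xs (<-irrefl refl) | below-∷-< xs y<x = s≤s (below-mono-≤ (<⇒≤ y<x) xs)
below-mono-< {x} {y} {z ∷ xs} y<x (there y∈xs) with z <? y
... | yes z<y rewrite below-∷-< xs z<y | below-∷-< xs (<-trans z<y y<x) = s≤s (below-mono-< y<x y∈xs)
... | no z≮y  rewrite below-∷-≮ xs z≮y = <-≤-trans (below-mono-< y<x y∈xs) (below-∷ z xs)

OrderEmbeddingOn : (ℕ → ℕ) → List ℕ → Set
OrderEmbeddingOn f xs = ∀ {x y} → x ∈ xs → y ∈ xs → x < y ⇔ f x < f y

rank-orderEmbedding : ∀ xs → OrderEmbeddingOn (rank xs) xs
rank-orderEmbedding xs {x} {y} x∈xs _ = mk⇔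
  (λ x<y → s≤s (below-mono-< x<y x∈xs))
  (λ rx<ry → decidable-stable (x <? y) (λ x≮y → <⇒≱ rx<ry (s≤s (below-mono-≤ (≮⇒≥ x≮y) xs))))

below-map : ∀ (f : ℕ → ℕ) x ys → (∀ {y} → y ∈ ys → y < x ⇔ f y < f x) →
            below (f x) (map f ys) ≡ below x ys
below-map f x []       _ = refl
below-map f x (y ∷ ys) order with y <? x
... | yes y<x rewrite below-∷-< (map f ys) (Equivalence.to (order (here refl)) y<x)
                    | below-∷-< ys y<x = cong suc (below-map f x ys (order ∘ there))
... | no y≮x  rewrite below-∷-≮ (map f ys) (y≮x ∘ Equivalence.from (order (here refl)))
                    | below-∷-≮ ys y≮x = below-map f x ys (order ∘ there)

standardize-map : ∀ {f xs} → OrderEmbeddingOn f xs → standardize (map f xs) ≡ standardize xs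
standardize-map {f} {xs} embedding = begin
  map (rank (map f xs)) (map f xs) ≡⟨ map-∘ xs ⟨
  map (rank (map f xs) ∘ f) xs     ≡⟨ map-cong-local (All.tabulate rank-map) ⟩
  map (rank xs) xs                 ∎
  where
  open ≡-Reasoning
  rank-map : ∀ {x} → x ∈ xs → rank (map f xs) (f x) ≡ rank xs x
  rank-map x∈xs = cong suc (below-map f _ xs (λ y∈xs → embedding y∈xs x∈xs))

standardize-select-standardize : (ψ : Thinning m n) (xs : List ℕ) →
  standardize (select ψ (standardize xs)) ≡ standardize (select ψ xs)
standardize-select-standardize ψ xs =
  trans (cong standardize (select-map (rank xs) ψ xs))
        (standardize-map (λ x∈ y∈ → rank-orderEmbedding xs (lookup ψ⊆ x∈) (lookup ψ⊆ y∈)))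
  where ψ⊆ = select-⊆ ψ xs

standardize-select-cong : (ψ : Thinning m n) {xs ys : List ℕ} → standardize xs ≡ standardize ys →
                          standardize (select ψ xs) ≡ standardize (select ψ ys)
standardize-select-cong ψ {xs} {ys} eq = begin
  standardize (select ψ xs)               ≡⟨ standardize-select-standardize ψ xs ⟨
  standardize (select ψ (standardize xs)) ≡⟨ cong (standardize ∘ select ψ) eq ⟩
  standardize (select ψ (standardize ys)) ≡⟨ standardize-select-standardize ψ ys ⟩
  standardize (select ψ ys)               ∎
  where open ≡-Reasoning

module _ (_≟ᴬ_ : DecidableEquality A) where

  deduplicate-⊆ : (xs : List A) → deduplicate _≟ᴬ_ xs ⊆ xs
  deduplicate-⊆ []       = []
  deduplicate-⊆ (x ∷ xs) = refl ∷ ⊆-trans (filter-⊆ (¬? ∘ (x ≟ᴬ_)) _) (deduplicate-⊆ xs)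

  Unique⇒deduplicate≡ : {xs : List A} → Unique xs → deduplicate _≟ᴬ_ xs ≡ xs
  Unique⇒deduplicate≡ []                     = refl
  Unique⇒deduplicate≡ {x ∷ xs} (x∉xs ∷ uniq) = cong (x ∷_) (begin
    filter (¬? ∘ (x ≟ᴬ_)) (deduplicate _≟ᴬ_ xs) ≡⟨ cong (filter (¬? ∘ (x ≟ᴬ_))) (Unique⇒deduplicate≡ uniq) ⟩
    filter (¬? ∘ (x ≟ᴬ_)) xs                    ≡⟨ filter-all (¬? ∘ (x ≟ᴬ_)) x∉xs ⟩
    xs                                          ∎)
    where open ≡-Reasoning

  -- deduplicate xs is a sublist of xs, so equal lengths force it to be xs itself.
  length-deduplicate≡⇒Unique : (xs : List A) → length (deduplicate _≟ᴬ_ xs) ≡ length xs → Unique xs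
  length-deduplicate≡⇒Unique xs eq =
    subst Unique (Pointwise-≡⇒≡ (toPointwise eq (deduplicate-⊆ xs))) (deduplicate-! _≟ᴬ_ xs)

Unique-map⇒injectiveOn : (f : A → B) {xs : List A} → Unique (map f xs) →
                         ∀ {x y} → x ∈ xs → y ∈ xs → f x ≡ f y → x ≡ y
Unique-map⇒injectiveOn f _                 (here refl)  (here refl)  _   = refl
Unique-map⇒injectiveOn f (fx∉ ∷ _)         (here refl)  (there y∈)   fx≡fy =
  ⊥-elim (All.lookup fx∉ (∈-map⁺ f y∈) fx≡fy)
Unique-map⇒injectiveOn f (fy∉ ∷ _)         (there x∈)   (here refl)  fx≡fy =
  ⊥-elim (All.lookup fy∉ (∈-map⁺ f x∈) (sym fx≡fy))
Unique-map⇒injectiveOn f (_ ∷ uniq)        (there x∈)   (there y∈)   fx≡fy =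
  Unique-map⇒injectiveOn f uniq x∈ y∈ fx≡fy

module Subpatterns (xs : List ℕ) where

  subpattern : Thinning m (length xs) → List ℕ
  subpattern θ = standardize (select θ xs)

  subpatterns : ℕ → List (List ℕ)
  subpatterns m = map standardize (subseqs m xs)

  subpatterns≡ : ∀ m → subpatterns m ≡ map subpattern (thinnings m (length xs))
  subpatterns≡ m = trans (cong (map standardize) (subseqs-thinnings m xs)) (sym (map-∘ _))

  length-subpatterns : ∀ m → length (subpatterns m) ≡ length xs C m
  length-subpatterns m = trans (cong length (subpatterns≡ m))
    (trans (length-map subpattern (thinnings m _)) (length-thinnings m _))

  subpattern-⊙ : (ψ : Thinning k m) {θ₁ θ₂ : Thinning m (length xs)} →
                 subpattern θ₁ ≡ subpattern θ₂ → subpattern (ψ ⊙ θ₁) ≡ subpattern (ψ ⊙ θ₂)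
  subpattern-⊙ ψ {θ₁} {θ₂} eq = begin
    standardize (select (ψ ⊙ θ₁) xs)     ≡⟨ cong standardize (select-⊙ ψ θ₁ xs) ⟩
    standardize (select ψ (select θ₁ xs)) ≡⟨ standardize-select-cong ψ eq ⟩
    standardize (select ψ (select θ₂ xs)) ≡⟨ cong standardize (select-⊙ ψ θ₂ xs) ⟨
    standardize (select (ψ ⊙ θ₂) xs)     ∎
    where open ≡-Reasoning

  subpattern-injective-mono : 1 ≤ k → k ≤ m →
    Injective _≡_ _≡_ (subpattern {k}) → Injective _≡_ _≡_ (subpattern {m})
  subpattern-injective-mono 1≤k k≤m injₖ {θ₁} {θ₂} eq =
    thinning-extensionality 1≤k k≤m θ₁ θ₂ (λ ψ → injₖ (subpattern-⊙ ψ {θ₁} {θ₂} eq))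

  all-distinct⇒injective : ∀ m → length (deduplicate (≡-dec _≟_) (subpatterns m)) ≡ length xs C m →
                           Injective _≡_ _≡_ (subpattern {m})
  all-distinct⇒injective m count =
    Unique-map⇒injectiveOn subpattern (subst Unique (subpatterns≡ m) uniq) (∈-thinnings _) (∈-thinnings _)
    where
    uniq = length-deduplicate≡⇒Unique (≡-dec _≟_) (subpatterns m) (trans count (sym (length-subpatterns m)))

  injective⇒all-distinct : ∀ m → Injective _≡_ _≡_ (subpattern {m}) →
                           length (deduplicate (≡-dec _≟_) (subpatterns m)) ≡ length xs C m
  injective⇒all-distinct m inj = trans (cong length (Unique⇒deduplicate≡ (≡-dec _≟_) uniq)) (length-subpatterns m)
    where
    uniq = subst Unique (sym (subpatterns≡ m)) (map⁺ inj (thinnings-Unique m _))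

length-oneLine : (p : Permutation′ n) → length (oneLine p) ≡ n
length-oneLine {n} p = trans (length-map _ (allFin n)) (length-tabulate {n = n} (λ i → i))

corollary5 : (n : ℕ) → 2 ≤ n → (k : ℕ) → 1 ≤ k → k ≤ n ∸ 1 →
    (p : Permutation′ n) → ∣D∣ k p ≡ n C k →
    (j : ℕ) → 1 ≤ j → j ≤ k → ∣D∣ j p ≡ n C j
corollary5 n _ k 1≤k k≤n-1 p ∣Dₖ∣ j _ j≤k =
  trans (injective⇒all-distinct (n ∸ j) injⱼ) (sym (C-complement j≤n))
  where
  open Subpatterns (oneLine p)
  C-complement : ∀ {i} → i ≤ n → n C i ≡ length (oneLine p) C (n ∸ i)
  C-complement {i} i≤n = trans (nCk≡nC[n∸k] i≤n) (cong (_C (n ∸ i)) (sym (length-oneLine p)))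
  k≤n = ≤-trans k≤n-1 (m∸n≤m n 1)
  j≤n = ≤-trans j≤k k≤n
  1≤n∸k : ∀ {n} → 1 ≤ k → k ≤ n ∸ 1 → 1 ≤ n ∸ k
  1≤n∸k {suc n} _       k≤n-1 = m<n⇒0<n∸m (s≤s k≤n-1)
  1≤n∸k {zero}  (s≤s _) ()
  injₖ = all-distinct⇒injective (n ∸ k) (trans ∣Dₖ∣ (C-complement k≤n))
  injⱼ = subpattern-injective-mono (1≤n∸k 1≤k k≤n-1) (∸-monoʳ-≤ n j≤k) injₖ
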